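{- Let $K$ be a configuration and $G$ a free completion of $K$ with ring $R$, where $R$ is a circuit of length $r$. Let $\mathcal{C}^*$ be the set of all maps $E(R)\to\{ -1,0,1\}$ (colorings of $R$), let $\mathcal{C}(K)$ be the set of restrictions to $E(R)$ of tri-colorings of $G$, and let $\mathcal{C}'(K)$ be the maximal consistent subset of $\mathcal{C}^*-\mathcal{C}(K)$. Let $\mathcal{C}_0=\mathcal{C}^*-\mathcal{C}(K)$ and let $\mathcal{M}_0$ be the set of all balanced signed matchings in $R$. For $i\ge 0$, define recursively $\mathcal{M}_{i+1}$ to be the set of all $M\in\mathcal{M}_i$ such that $\mathcal{C}_i$ contains every coloring $\kappa$ of $R$ that $\theta$-fits $M$ for some $\theta\in\{ -1,0,1\}$, and $\mathcal{C}_{i+1}$ to be the set of all $\kappa\in\mathcal{C}_i$ such that for every $\theta\in\{ -1,0,1\}$ there is $M\in\mathcal{M}_{i+1}$ such that $\kappa$ $\theta$-fits $M$. If $\mathcal{C}_i=\mathcal{C}_{i+1}$ for some integer $i\ge 0$, then $\mathcal{C}'(K)=\mathcal{C}_i$.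
   Context: A near-triangulation is a non-null connected loopless plane graph in which every finite region is a triangle. A configuration $K$ consists of a near-triangulation $G(K)$ and a map $\gamma_K:V(G(K))\to\mathbb{Z}$ such that: (i) for every vertex $v$, $G(K)\setminus v$ has at most two components, and if two then $\gamma_K(v)=d(v)+2$; (ii) if $v$ is not incident with the infinite region then $\gamma_K(v)=d(v)$, otherwise $\gamma_K(v)>d(v)$, and always $\gamma_K(v)\ge5$; (iii) the ring-size $\sum(\gamma_K(v)-d(v)-1)$, over vertices $v$ on the infinite region with $G(K)\setminus v$ connected, is at least $2$. A free completion of $K$ with ring $R$ is a near-triangulation $G$ containing an induced circuit $R$ bounding its infinite region with $G\setminus V(R)=G(K)$ and $d_G(v)=\gamma_K(v)$ for $v\in V(G(K))$. A tri-coloring of $G$ is a map $E(G)\to\{ -1,0,1\}$ such that the three edges bounding each finite region receive distinct values. A match in $R$ is an unordered pair $\{e,f\}$ of distinct edges of $R$; a signed match is a pair $(m,\mu)$ with $m$ a match and $\mu\in\{ -1,1\}$. A signed matching in $R$ is a set $M=\{(m_1,\mu_1),\ldots,(m_k,\mu_k)\}$ of signed matches such that for distinct $m_i=\{e,f\}$, $m_j=\{g,h\}$ we have $m_i\cap m_j=\emptyset$ and $g,h$ lie in the same component of $R\setminus\{e,f\}$ (the matches do not cross). $M$ is balanced if $r-\sum_{i=1}^k(\mu_i-1)/2$ is even. For $\theta\in\{ -1,0,1\}$, a coloring $\kappa$ of $R$ $\theta$-fits $M$ if for every $e\in E(R)$, $\kappa(e)\ne\theta$ if and only if $e$ belongs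 to some $m_i$, and for every $(\{e,f\},\mu)\in M$, $\kappa(e)=\kappa(f)$ if and only if $\mu=1$. A set $\mathcal{C}$ of colorings of $R$ is consistent if for every $\kappa\in\mathcal{C}$ and every $\theta\in\{ -1,0,1\}$ there is a signed matching $M$ in $R$ such that $\kappa$ $\theta$-fits $M$ and every coloring of $R$ that $\theta$-fits $M$ belongs to $\mathcal{C}$. (A union of consistent sets is consistent, so a set has a unique maximal consistent subset.) -}

module Defs where

open import Level using (Level)
open import Data.Nat using (ℕ; zero; suc; _+_; _≤_; _<_; _∸_)
open import Data.Nat.Divisibility using (_∣_)
open import Data.Fin using (Fin; toℕ)
open import Data.Fin.Properties using (_≟_; any?)
open import Data.Bool using (Bool; true; false; if_then_else_; not; _∧_)
open import Data.Product using (Σ; ∃; _×_; _,_)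
open import Data.Sum using (_⊎_)
open import Data.List using (List)
open import Data.List.Membership.Propositional using (_∈_)
open import Data.List.Relation.Unary.Unique.Propositional using (Unique)
open import Relation.Nullary using (¬_)
open import Relation.Nullary.Decidable using (⌊_⌋)
open import Relation.Binary.PropositionalEquality using (_≡_; _≢_)
open import Relation.Binary.Construct.Closure.ReflexiveTransitive using (Star)
open import Function using (_∘_)

Iff : ∀ {a b : Level} → Set a → Set b → Set _
Iff A B = (A → B) × (B → A)

iter : {A : Set} → (A → A) → ℕ → A → A
iter f zero x = x
iter f (suc k) x = f (iter f k x)

SameOrbit : {A : Set} → (A → A) → A → A → Set
SameOrbit f x y = Σ ℕ λ k → iter f k x ≡ y

count : ∀ {n} → (Fin n → Bool) → ℕ
count {zero} p = 0
count {suc n} p = (if p Fin.zero then 1 else 0) + count (p ∘ Fin.suc)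

sumFin : ∀ {n} → (Fin n → ℕ) → ℕ
sumFin {zero} f = 0
sumFin {suc n} f = f Fin.zero + sumFin (f ∘ Fin.suc)

-- Connected plane graphs, encoded as combinatorial maps (rotation systems).
-- Darts (half-edges) Fin nD; α = the other half of the same edge;
-- σ = rotation (next dart around the same vertex); the regions are the
-- orbits of φ = σ ∘ α.  Genus 0 (i.e. the map is a plane embedding) is
-- expressed by Euler's formula V - E + F = 2 for connected maps.
-- (A one-vertex graph has no darts; vertices without darts are allowed
-- but connectivity then forces the graph to be that single vertex.)

record PlaneMap : Set where
  field
    nD nV nE nF : ℕ
    α σ σ⁻ : Fin nD → Fin nD
    vert : Fin nD → Fin nV
    edge : Fin nD → Fin nE
    face : Fin nD → Fin nF
    α-invol : ∀ x → α (α x) ≡ x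
    α-fpf   : ∀ x → α x ≢ x
    σσ⁻ : ∀ x → σ (σ⁻ x) ≡ x
    σ⁻σ : ∀ x → σ⁻ (σ x) ≡ x
    vert-orbit : ∀ x y → Iff (vert x ≡ vert y) (SameOrbit σ x y)
    edge-orbit : ∀ x y → Iff (edge x ≡ edge y) (y ≡ x ⊎ y ≡ α x)
    face-orbit : ∀ x y → Iff (face x ≡ face y) (SameOrbit (λ z → σ (α z)) x y)
    edge-surj : ∀ e → ∃ λ x → edge x ≡ e
    face-surj : ∀ f → ∃ λ x → face x ≡ f
    connected : ∀ u v → Star (λ a b → ∃ λ x → vert x ≡ a × vert (α x) ≡ b) u v
    euler : nD ≡ 0 ⊎ nV + nF ≡ nE + 2

data Col : Set where
  c-1 c0 c+1 : Col

data Sign : Set where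
  s-1 s+1 : Sign

-- A near-triangulation G together with an induced circuit R bounding its
-- infinite region (the data of a free completion).  The ring R has edges
-- indexed by Fin r in cyclic order: ringDart i is the dart of the i-th
-- ring edge, traversed along the boundary walk of the infinite region.

record RingedNearTriangulation : Set where
  field
    G : PlaneMap
  open PlaneMap G public
  field
    loopless : ∀ x → vert (α x) ≢ vert x
    outer : Fin nF
    finite-triangles : ∀ f → f ≢ outer → count (λ x → ⌊ face x ≟ f ⌋) ≡ 3
    r : ℕ
    ringDart : Fin r → Fin nD
    ring-outer : ∀ i → face (ringDart i) ≡ outer
    ring-all : ∀ x → face x ≡ outer → ∃ λ i → ringDart i ≡ x
    ring-cyclic : ∀ i j → (suc (toℕ i) ≡ toℕ j ⊎ (suc (toℕ i) ≡ r × toℕ j ≡ 0)) →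
                  σ (α (ringDart i)) ≡ ringDart j
    ring-vertices-distinct : ∀ i j → vert (ringDart i) ≡ vert (ringDart j) → i ≡ j
    ring-edges-distinct : ∀ i j → edge (ringDart i) ≡ edge (ringDart j) → i ≡ j
    ring-induced : ∀ x → (∃ λ i → vert (ringDart i) ≡ vert x) →
                   (∃ λ j → vert (ringDart j) ≡ vert (α x)) →
                   ∃ λ k → edge (ringDart k) ≡ edge x

-- The configuration K = (G \ V(R), d_G) determined by a free completion.

module _ (T : RingedNearTriangulation) where
  open RingedNearTriangulation T

  RingV : Fin nV → Set
  RingV v = ∃ λ i → vert (ringDart i) ≡ v

  isRingV : Fin nV → Bool
  isRingV v = ⌊ any? (λ i → vert (ringDart i) ≟ v) ⌋

  InK : Fin nV → Set
  InK v = ¬ RingV v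

  degG : Fin nV → ℕ
  degG v = count (λ x → ⌊ vert x ≟ v ⌋)

  degK : Fin nV → ℕ
  degK v = count (λ x → ⌊ vert x ≟ v ⌋ ∧ not (isRingV (vert (α x))))

  γK : Fin nV → ℕ
  γK = degG

  AdjG : Fin nV → Fin nV → Set
  AdjG a b = ∃ λ x → vert x ≡ a × vert (α x) ≡ b

  AdjKminus : Fin nV → Fin nV → Fin nV → Set
  AdjKminus w a b = InK a × InK b × a ≢ w × b ≢ w × AdjG a b

  AdjK : Fin nV → Fin nV → Set
  AdjK a b = InK a × InK b × AdjG a b

  ConnKminus : Fin nV → Fin nV → Fin nV → Set
  ConnKminus w a b = Star (AdjKminus w) a b

  InKminus : Fin nV → Fin nV → Set
  InKminus w a = InK a × a ≢ w

  AtMostTwoComponents : Fin nV → Set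
  AtMostTwoComponents w = ∀ a b c → InKminus w a → InKminus w b → InKminus w c →
    ConnKminus w a b ⊎ ConnKminus w b c ⊎ ConnKminus w a c

  -- G(K) \ w is disconnected (given at most two components: exactly two)
  Disconnected : Fin nV → Set
  Disconnected w = ∃ λ a → ∃ λ b → InKminus w a × InKminus w b × ¬ ConnKminus w a b

  -- v ∈ V(G(K)) is incident with the infinite region of G(K)
  -- (v has a neighbour on R in G)
  OnInfinite : Fin nV → Set
  OnInfinite v = ∃ λ x → vert x ≡ v × RingV (vert (α x))

  IsConfiguration : Set
  IsConfiguration =
      -- G(K) is a non-null connected (loopless, inherited) near-triangulation
      (∃ λ v → InK v)
    × (∀ u v → InK u → InK v → Star AdjK u v)
    × (∀ v → InK v → AtMostTwoComponents v × (Disconnected v → γK v ≡ degK v + 2))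
    × (∀ v → InK v → (¬ OnInfinite v → γK v ≡ degK v)
                   × (OnInfinite v → degK v < γK v)
                   × 5 ≤ γK v)
    × (∃ λ (S : Fin nV → Bool) →
         (∀ v → Iff (S v ≡ true) (InK v × OnInfinite v × ¬ Disconnected v))
       × 2 ≤ sumFin (λ v → if S v then γK v ∸ degK v ∸ 1 else 0))

  TriColoring : (Fin nE → Col) → Set
  TriColoring τ = ∀ x y → face x ≡ face y → face x ≢ outer → x ≢ y →
                  τ (edge x) ≢ τ (edge y)

  CK : (Fin r → Col) → Set
  CK κ = Σ (Fin nE → Col) λ τ → TriColoring τ × (∀ i → τ (edge (ringDart i)) ≡ κ i)

-- Signed matchings in a circuit R with edges Fin r in cyclic order.

module Ring (r : ℕ) where

  Coloring : Set
  Coloring = Fin r → Col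

  -- a signed match: the match {e,f} is stored as (e , f) with e < f
  SignedMatch : Set
  SignedMatch = Fin r × Fin r × Sign

  IsMatch : SignedMatch → Set
  IsMatch (e , f , μ) = toℕ e < toℕ f

  Between : Fin r → Fin r → Fin r → Set
  Between e f g = toℕ e < toℕ g × toℕ g < toℕ f

  -- distinct matches are disjoint and do not cross
  Compatible : SignedMatch → SignedMatch → Set
  Compatible (e , f , _) (g , h , _) =
    e ≢ g × e ≢ h × f ≢ g × f ≢ h × Iff (Between e f g) (Between e f h)

  -- a signed matching: a finite set of signed matches (as a list without
  -- repetitions) with pairwise compatible entries
  SignedMatching : List SignedMatch → Set
  SignedMatching M = Unique M × (∀ m → m ∈ M → IsMatch m) ×
    (∀ m n → (pm : m ∈ M) → (pn : n ∈ M) → ¬ (m ≡ n) → Compatible m n)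

  InMatch : Fin r → List SignedMatch → Set
  InMatch e M = ∃ λ f → ∃ λ μ → ((e , f , μ) ∈ M) ⊎ ((f , e , μ) ∈ M)

  countMinus : List SignedMatch → ℕ
  countMinus List.[] = 0
  countMinus ((e , f , s-1) List.∷ M) = suc (countMinus M)
  countMinus ((e , f , s+1) List.∷ M) = countMinus M

  -- r - Σ (μ_i - 1)/2 = r + #{i : μ_i = -1} is even
  Balanced : List SignedMatch → Set
  Balanced M = 2 ∣ (r + countMinus M)

  Fits : Col → Coloring → List SignedMatch → Set
  Fits θ κ M = (∀ e → Iff (κ e ≢ θ) (InMatch e M))
             × (∀ e f μ → (e , f , μ) ∈ M → Iff (κ e ≡ κ f) (μ ≡ s+1))

  Consistent : (Coloring → Set) → Set
  Consistent 𝒞 = ∀ κ → 𝒞 κ → ∀ θ → ∃ λ M → SignedMatching M × Fits θ κ M ×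
                 (∀ κ′ → Fits θ κ′ M → 𝒞 κ′)

  -- the maximal consistent subset of 𝒞 (union of all consistent subsets)
  MaxConsistent : (Coloring → Set) → Coloring → Set₁
  MaxConsistent 𝒞 κ = Σ (Coloring → Set) λ 𝒟 → Consistent 𝒟 × (∀ κ′ → 𝒟 κ′ → 𝒞 κ′) × 𝒟 κ

  iterMC : (Coloring → Set) → ℕ → (List SignedMatch → Set) × (Coloring → Set)
  iterMC 𝒞₀ zero = (λ M → SignedMatching M × Balanced M) , 𝒞₀
  iterMC 𝒞₀ (suc i) with iterMC 𝒞₀ i
  ... | (𝓜ᵢ , 𝒞ᵢ) =
    let 𝓜ᵢ₊₁ : List SignedMatch → Set
        𝓜ᵢ₊₁ M = 𝓜ᵢ M × (∀ κ θ → Fits θ κ M → 𝒞ᵢ κ)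
    in 𝓜ᵢ₊₁ , (λ κ → 𝒞ᵢ κ × (∀ θ → ∃ λ M → 𝓜ᵢ₊₁ M × Fits θ κ M))

  𝓜 : (Coloring → Set) → ℕ → List SignedMatch → Set
  𝓜 𝒞₀ i = Data.Product.proj₁ (iterMC 𝒞₀ i)

  𝒞 : (Coloring → Set) → ℕ → Coloring → Set
  𝒞 𝒞₀ i = Data.Product.proj₂ (iterMC 𝒞₀ i)

module Submission where

-- If 𝒞ᵢ = 𝒞ᵢ₊₁ then 𝒞ᵢ is consistent: the matchings witnessing κ ∈ 𝒞ᵢ₊₁
-- lie in 𝓜ᵢ₊₁, so all their fitting colourings lie in 𝒞ᵢ.  Hence 𝒞ᵢ is
-- contained in the maximal consistent subset 𝒞′ of 𝒞₀.
--
-- Conversely 𝒞′ ⊆ 𝒞ⱼ for every j, by induction on j together with the claim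
-- that every "good" signed matching (balanced, and all of whose fitting
-- colourings lie in 𝒞′) belongs to 𝓜ⱼ.  The matching M that a consistent
-- 𝒟 ⊆ 𝒞₀ provides for κ ∈ 𝒟 and θ is good:
--   * balance is a parity count: if κ θ-fits M and θ′-fits some M′ (θ′ ≠ θ),
--     the edges of colour θ′ number #(minus-signed matches of M) mod 2, the
--     other edges are paired by M′, and together they are the r ring edges;
--   * a colouring θ′-fitting M becomes θ-fitting after a rotation of the
--     colours taking θ′ to θ, so it lies in a recoloured copy of 𝒟, which is
--     again consistent and contained in 𝒞₀.

open import Defs
open import Data.Nat using (ℕ; suc)
open import Data.Product using (_×_)
open import Relation.Nullary using (¬_)

open import Data.Nat using (zero; _+_)
open import Data.Nat.Divisibility using (_∣_; divides; _∣0; ∣m∣n⇒∣m+n)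
open import Data.Nat.Properties using (+-assoc; +-suc; <-irrefl; +-commutativeSemigroup)
open import Algebra.Properties.CommutativeSemigroup +-commutativeSemigroup
  using (interchange; x∙yz≈y∙xz; xy∙z≈xz∙y)
open import Data.Bool using (Bool; true; false; not; _∧_; if_then_else_)
open import Data.Bool.Properties using (∧-zeroʳ; ∧-identityʳ)
open import Data.Fin using (Fin) renaming (zero to fzero; suc to fsuc)
open import Data.Fin.Properties using (_≟_)
open import Data.Product using (∃; _,_; proj₁; proj₂)
open import Data.Sum using (_⊎_; inj₁; inj₂)
open import Data.Empty using (⊥-elim)
open import Data.List using (List; []; _∷_)
open import Data.List.Membership.Propositional using (_∈_)
open import Data.List.Relation.Unary.Any using (here; there)
open import Data.List.Relation.Unary.All using () renaming (lookup to lookupAll)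
open import Data.List.Relation.Unary.AllPairs using (_∷_)
open import Relation.Nullary using (yes; no; does)
open import Relation.Nullary.Decidable using (dec-true; dec-false)
open import Relation.Binary.Definitions using (DecidableEquality)
open import Relation.Binary.PropositionalEquality
  using (_≡_; _≢_; refl; sym; trans; cong; cong₂; subst; module ≡-Reasoning)
open import Function using (_∘_)
open import Function.Definitions using (Injective)

open ≡-Reasoning

_≟ᶜ_ : DecidableEquality Col
c-1 ≟ᶜ c-1 = yes refl
c-1 ≟ᶜ c0  = no λ ()
c-1 ≟ᶜ c+1 = no λ ()
c0  ≟ᶜ c-1 = no λ ()
c0  ≟ᶜ c0  = yes refl
c0  ≟ᶜ c+1 = no λ ()
c+1 ≟ᶜ c-1 = no λ ()
c+1 ≟ᶜ c0  = no λ ()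
c+1 ≟ᶜ c+1 = yes refl

-- The cyclic permutation -1 ↦ 0 ↦ 1 ↦ -1; its powers act transitively on
-- the colours, which is all the colour symmetry the proof needs.
rot : Col → Col
rot c-1 = c0
rot c0  = c+1
rot c+1 = c-1

rot-cube : ∀ c → rot (rot (rot c)) ≡ c
rot-cube c-1 = refl
rot-cube c0  = refl
rot-cube c+1 = refl

rot-injective : Injective _≡_ _≡_ rot
rot-injective {x} {y} rx≡ry = begin
  x                 ≡⟨ rot-cube x ⟨
  rot (rot (rot x)) ≡⟨ cong (rot ∘ rot) rx≡ry ⟩
  rot (rot (rot y)) ≡⟨ rot-cube y ⟩
  y                 ∎

rot-moves : ∀ θ → rot θ ≢ θ
rot-moves c-1 ()
rot-moves c0  ()
rot-moves c+1 ()

other-colours : ∀ {θ x} → x ≢ θ → x ≡ rot θ ⊎ x ≡ rot (rot θ)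
other-colours {c-1} {c-1} x≢θ = ⊥-elim (x≢θ refl)
other-colours {c-1} {c0}  _   = inj₁ refl
other-colours {c-1} {c+1} _   = inj₂ refl
other-colours {c0}  {c-1} _   = inj₂ refl
other-colours {c0}  {c0}  x≢θ = ⊥-elim (x≢θ refl)
other-colours {c0}  {c+1} _   = inj₁ refl
other-colours {c+1} {c-1} _   = inj₁ refl
other-colours {c+1} {c0}  _   = inj₂ refl
other-colours {c+1} {c+1} x≢θ = ⊥-elim (x≢θ refl)

rot-transitive : ∀ θ′ θ → ∃ λ k → iter rot k θ′ ≡ θ
rot-transitive θ′ θ with θ ≟ᶜ θ′
... | yes θ≡θ′ = 0 , sym θ≡θ′
... | no θ≢θ′ with other-colours θ≢θ′
...   | inj₁ θ≡rotθ′  = 1 , sym θ≡rotθ′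
...   | inj₂ θ≡rot²θ′ = 2 , sym θ≡rot²θ′

iter-injective : ∀ {A : Set} {f : A → A} → Injective _≡_ _≡_ f → ∀ k → Injective _≡_ _≡_ (iter f k)
iter-injective f-inj zero    eq = eq
iter-injective f-inj (suc k) eq = iter-injective f-inj k (f-inj eq)

pigeonhole : ∀ {θ a x y} → a ≢ θ → x ≢ θ → y ≢ θ → x ≢ y → a ≡ x ⊎ a ≡ y
pigeonhole a≢θ x≢θ y≢θ x≢y with other-colours a≢θ | other-colours x≢θ | other-colours y≢θ
... | inj₁ a≡ | inj₁ x≡ | _       = inj₁ (trans a≡ (sym x≡))
... | inj₂ a≡ | inj₂ x≡ | _       = inj₁ (trans a≡ (sym x≡))
... | inj₁ a≡ | inj₂ _  | inj₁ y≡ = inj₂ (trans a≡ (sym y≡))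
... | inj₂ a≡ | inj₁ _  | inj₂ y≡ = inj₂ (trans a≡ (sym y≡))
... | inj₁ _  | inj₂ x≡ | inj₂ y≡ = ⊥-elim (x≢y (trans x≡ (sym y≡)))
... | inj₂ _  | inj₁ x≡ | inj₁ y≡ = ⊥-elim (x≢y (trans x≡ (sym y≡)))

⟦_⟧ : Bool → ℕ
⟦ b ⟧ = if b then 1 else 0

⟦b⟧+⟦b⟧-even : ∀ b → 2 ∣ ⟦ b ⟧ + ⟦ b ⟧ + 0
⟦b⟧+⟦b⟧-even true  = divides 1 refl
⟦b⟧+⟦b⟧-even false = 2 ∣0

count-cong : ∀ {n} {p q : Fin n → Bool} → (∀ x → p x ≡ q x) → count p ≡ count q
count-cong {zero}  _   = refl
count-cong {suc n} p≗q = cong₂ _+_ (cong ⟦_⟧ (p≗q fzero)) (count-cong (p≗q ∘ fsuc))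

count-none : ∀ {n} (p : Fin n → Bool) → (∀ x → p x ≡ false) → count p ≡ 0
count-none {zero}  _ _    = refl
count-none {suc n} p none = cong₂ _+_ (cong ⟦_⟧ (none fzero)) (count-none (p ∘ fsuc) (none ∘ fsuc))

count-complement : ∀ {n} (p : Fin n → Bool) → count p + count (not ∘ p) ≡ n
count-complement {zero}  p = refl
count-complement {suc n} p with p fzero
... | true  = cong suc (count-complement (p ∘ fsuc))
... | false = trans (+-suc _ _) (cong suc (count-complement (p ∘ fsuc)))

_without_ : ∀ {n} → (Fin n → Bool) → Fin n → Fin n → Bool
(p without e) x = p x ∧ not (does (x ≟ e))

without-true : ∀ {n} (p : Fin n → Bool) e x → (p without e) x ≡ true → p x ≡ true × x ≢ e
without-true p e x eq with p x | x ≟ e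
without-true p e x refl | true  | no x≢e = refl , x≢e
without-true p e x ()   | true  | yes _
without-true p e x ()   | false | _

without-elsewhere : ∀ {n} (p : Fin n → Bool) {e x} → x ≢ e → (p without e) x ≡ p x
without-elsewhere p {e} {x} x≢e rewrite dec-false (x ≟ e) x≢e = ∧-identityʳ (p x)

count-without : ∀ {n} (p : Fin n → Bool) e → count p ≡ ⟦ p e ⟧ + count (p without e)
count-without p fzero = cong (⟦ p fzero ⟧ +_) (sym (cong₂ _+_
  (cong ⟦_⟧ (∧-zeroʳ (p fzero))) (count-cong (λ x → ∧-identityʳ (p (fsuc x))))))
count-without p (fsuc e) = begin
  ⟦ p fzero ⟧ + count (p ∘ fsuc)
    ≡⟨ cong (⟦ p fzero ⟧ +_) (count-without (p ∘ fsuc) e) ⟩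
  ⟦ p fzero ⟧ + (⟦ p (fsuc e) ⟧ + count ((p ∘ fsuc) without e))
    ≡⟨ x∙yz≈y∙xz ⟦ p fzero ⟧ ⟦ p (fsuc e) ⟧ _ ⟩
  ⟦ p (fsuc e) ⟧ + (⟦ p fzero ⟧ + count ((p ∘ fsuc) without e))
    ≡⟨ cong (λ b → ⟦ p (fsuc e) ⟧ + (⟦ b ⟧ + count ((p ∘ fsuc) without e))) (∧-identityʳ (p fzero)) ⟨
  ⟦ p (fsuc e) ⟧ + count (p without fsuc e) ∎

isMinus : Sign → Bool
isMinus s-1 = true
isMinus s+1 = false

exactly-one : ∀ {θ a x y} → a ≢ θ → x ≢ θ → y ≢ θ → x ≢ y →
              ⟦ does (x ≟ᶜ a) ⟧ + ⟦ does (y ≟ᶜ a) ⟧ ≡ 1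
exactly-one {x = x} {y} a≢θ x≢θ y≢θ x≢y with pigeonhole a≢θ x≢θ y≢θ x≢y
... | inj₁ refl rewrite dec-true (x ≟ᶜ x) refl | dec-false (y ≟ᶜ x) (x≢y ∘ sym) = refl
... | inj₂ refl rewrite dec-false (x ≟ᶜ y) x≢y | dec-true (y ≟ᶜ y) refl = refl

pair-parity : ∀ {θ a x y} μ → a ≢ θ → x ≢ θ → y ≢ θ → Iff (x ≡ y) (μ ≡ s+1) →
              2 ∣ ⟦ does (x ≟ᶜ a) ⟧ + ⟦ does (y ≟ᶜ a) ⟧ + ⟦ isMinus μ ⟧
pair-parity {a = a} {y = y} s+1 _ _ _ (_ , same) rewrite same refl = ⟦b⟧+⟦b⟧-even (does (y ≟ᶜ a))
pair-parity {x = x} {y} s-1 a≢θ x≢θ y≢θ (same , _) =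
  subst (λ n → 2 ∣ n + 1) (sym (exactly-one a≢θ x≢θ y≢θ x≢y)) (divides 1 refl)
  where
    x≢y : x ≢ y
    x≢y x≡y with same x≡y
    ... | ()

module SignedMatchings (r : ℕ) where
  open Ring r

  countMinus-cons : ∀ e f μ M → countMinus ((e , f , μ) ∷ M) ≡ ⟦ isMinus μ ⟧ + countMinus M
  countMinus-cons e f s-1 M = refl
  countMinus-cons e f s+1 M = refl

  endCount : (Fin r → Bool) → List SignedMatch → ℕ
  endCount p []                = 0
  endCount p ((e , f , _) ∷ M) = ⟦ p e ⟧ + ⟦ p f ⟧ + endCount p M

  endCount-cong : ∀ {p q} M → (∀ e f μ → (e , f , μ) ∈ M → p e ≡ q e × p f ≡ q f) →
                  endCount p M ≡ endCount q M
  endCount-cong []                _   = refl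
  endCount-cong ((e , f , μ) ∷ M) p≗q with p≗q e f μ (here refl)
  ... | pe≡qe , pf≡qf = cong₂ _+_ (cong₂ _+_ (cong ⟦_⟧ pe≡qe) (cong ⟦_⟧ pf≡qf))
                                  (endCount-cong M (λ g h ν m → p≗q g h ν (there m)))

  endCount-even : ∀ p M → (∀ e f μ → (e , f , μ) ∈ M → 2 ∣ ⟦ p e ⟧ + ⟦ p f ⟧) → 2 ∣ endCount p M
  endCount-even p []                _    = 2 ∣0
  endCount-even p ((e , f , μ) ∷ M) even =
    ∣m∣n⇒∣m+n (even e f μ (here refl)) (endCount-even p M (λ g h ν m → even g h ν (there m)))

  endCount+minus-even : ∀ p M → (∀ e f μ → (e , f , μ) ∈ M → 2 ∣ ⟦ p e ⟧ + ⟦ p f ⟧ + ⟦ isMinus μ ⟧) →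
                        2 ∣ endCount p M + countMinus M
  endCount+minus-even p []                _    = 2 ∣0
  endCount+minus-even p ((e , f , μ) ∷ M) even = subst (2 ∣_) regroup
    (∣m∣n⇒∣m+n (even e f μ (here refl)) (endCount+minus-even p M (λ g h ν m → even g h ν (there m))))
    where
      regroup : ⟦ p e ⟧ + ⟦ p f ⟧ + ⟦ isMinus μ ⟧ + (endCount p M + countMinus M)
              ≡ endCount p ((e , f , μ) ∷ M) + countMinus ((e , f , μ) ∷ M)
      regroup = begin
        ⟦ p e ⟧ + ⟦ p f ⟧ + ⟦ isMinus μ ⟧ + (endCount p M + countMinus M)
          ≡⟨ interchange (⟦ p e ⟧ + ⟦ p f ⟧) ⟦ isMinus μ ⟧ (endCount p M) (countMinus M) ⟩
        ⟦ p e ⟧ + ⟦ p f ⟧ + endCount p M + (⟦ isMinus μ ⟧ + countMinus M)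
          ≡⟨ cong (endCount p ((e , f , μ) ∷ M) +_) (countMinus-cons e f μ M) ⟨
        endCount p ((e , f , μ) ∷ M) + countMinus ((e , f , μ) ∷ M) ∎

  matching-tail : ∀ {m M} → SignedMatching (m ∷ M) → SignedMatching M
  matching-tail (_ ∷ unique , isMatch , compatible) =
    unique , (λ n n∈M → isMatch n (there n∈M)) , (λ m n m∈M n∈M → compatible m n (there m∈M) (there n∈M))

  match-ends-distinct : ∀ {e f μ M} → SignedMatching ((e , f , μ) ∷ M) → e ≢ f
  match-ends-distinct (_ , isMatch , _) refl = <-irrefl refl (isMatch _ (here refl))

  matches-disjoint : ∀ {e f μ g h ν M} → SignedMatching ((e , f , μ) ∷ M) → (g , h , ν) ∈ M →
                     (e ≢ g × e ≢ h) × (f ≢ g × f ≢ h)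
  matches-disjoint (head-new ∷ _ , _ , compatible) gh∈M
    with compatible _ _ (here refl) (there gh∈M) (lookupAll head-new gh∈M)
  ... | e≢g , e≢h , f≢g , f≢h , _ = (e≢g , e≢h) , (f≢g , f≢h)

  inMatch-tail : ∀ {x e f μ M} → InMatch x ((e , f , μ) ∷ M) → x ≢ e → x ≢ f → InMatch x M
  inMatch-tail (_  , _  , inj₁ (here refl)) x≢e _   = ⊥-elim (x≢e refl)
  inMatch-tail (_  , _  , inj₂ (here refl)) _   x≢f = ⊥-elim (x≢f refl)
  inMatch-tail (f′ , μ′ , inj₁ (there m))   _   _   = f′ , μ′ , inj₁ m
  inMatch-tail (f′ , μ′ , inj₂ (there m))   _   _   = f′ , μ′ , inj₂ m

  double-count : ∀ {M} → SignedMatching M → (p : Fin r → Bool) →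
                 (∀ x → p x ≡ true → InMatch x M) → count p ≡ endCount p M
  double-count {[]} _ p support = count-none p nowhere
    where
      nowhere : ∀ x → p x ≡ false
      nowhere x with p x in px
      ... | false = refl
      ... | true with support x px
      ...   | _ , _ , inj₁ ()
      ...   | _ , _ , inj₂ ()
  double-count {(e , f , μ) ∷ M} matching p support = begin
    count p                                      ≡⟨ count-without p e ⟩
    ⟦ p e ⟧ + count (p without e)                ≡⟨ cong (⟦ p e ⟧ +_) (count-without (p without e) f) ⟩
    ⟦ p e ⟧ + (⟦ (p without e) f ⟧ + count rest) ≡⟨ cong (λ b → ⟦ p e ⟧ + (⟦ b ⟧ + count rest)) p-at-f ⟩
    ⟦ p e ⟧ + (⟦ p f ⟧ + count rest)             ≡⟨ cong (λ n → ⟦ p e ⟧ + (⟦ p f ⟧ + n)) rest-count ⟩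
    ⟦ p e ⟧ + (⟦ p f ⟧ + endCount p M)           ≡⟨ +-assoc ⟦ p e ⟧ ⟦ p f ⟧ (endCount p M) ⟨
    endCount p ((e , f , μ) ∷ M)                 ∎
    where
      rest : Fin r → Bool
      rest = (p without e) without f
      e≢f : e ≢ f
      e≢f = match-ends-distinct matching
      p-at-f : (p without e) f ≡ p f
      p-at-f = without-elsewhere p (e≢f ∘ sym)
      rest-support : ∀ x → rest x ≡ true → InMatch x M
      rest-support x restx with without-true (p without e) f x restx
      ... | p∖e-x , x≢f with without-true p e x p∖e-x
      ...   | px , x≢e = inMatch-tail (support x px) x≢e x≢f
      rest-agrees : ∀ g h ν → (g , h , ν) ∈ M → rest g ≡ p g × rest h ≡ p h
      rest-agrees g h ν gh∈M with matches-disjoint matching gh∈M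
      ... | (e≢g , e≢h) , (f≢g , f≢h) =
        trans (without-elsewhere (p without e) (f≢g ∘ sym)) (without-elsewhere p (e≢g ∘ sym)) ,
        trans (without-elsewhere (p without e) (f≢h ∘ sym)) (without-elsewhere p (e≢h ∘ sym))
      rest-count : count rest ≡ endCount p M
      rest-count = trans (double-count (matching-tail matching) rest rest-support) (endCount-cong M rest-agrees)

  hasColour : Coloring → Col → Fin r → Bool
  hasColour κ a x = does (κ x ≟ᶜ a)

  fit-support : ∀ {θ κ M x} → Fits θ κ M → κ x ≢ θ → InMatch x M
  fit-support (support , _) κx≢θ = proj₁ (support _) κx≢θ

  fit-ends : ∀ {θ κ M e f μ} → Fits θ κ M → (e , f , μ) ∈ M → κ e ≢ θ × κ f ≢ θ
  fit-ends (support , _) m = proj₂ (support _) (_ , _ , inj₁ m) , proj₂ (support _) (_ , _ , inj₂ m)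

  -- If κ θ-fits M, the edges not coloured θ are the ends of M: evenly many.
  off-colour-even : ∀ {θ κ M} → SignedMatching M → Fits θ κ M → 2 ∣ count (not ∘ hasColour κ θ)
  off-colour-even {θ} {κ} {M} matching fit =
    subst (2 ∣_) (sym (double-count matching _ support)) (endCount-even _ M both-ends)
    where
      support : ∀ x → not (hasColour κ θ x) ≡ true → InMatch x M
      support x off with κ x ≟ᶜ θ
      ... | no κx≢θ = fit-support fit κx≢θ
      both-ends : ∀ e f μ → (e , f , μ) ∈ M → 2 ∣ ⟦ not (hasColour κ θ e) ⟧ + ⟦ not (hasColour κ θ f) ⟧
      both-ends e f μ m with fit-ends fit m
      ... | κe≢θ , κf≢θ rewrite dec-false (κ e ≟ᶜ θ) κe≢θ | dec-false (κ f ≟ᶜ θ) κf≢θ = divides 1 refl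

  colour-count-parity : ∀ {θ a κ M} → SignedMatching M → Fits θ κ M → a ≢ θ →
                        2 ∣ count (hasColour κ a) + countMinus M
  colour-count-parity {θ} {a} {κ} {M} matching fit a≢θ =
    subst (λ n → 2 ∣ n + countMinus M) (sym (double-count matching _ support))
      (endCount+minus-even _ M per-match)
    where
      support : ∀ x → hasColour κ a x ≡ true → InMatch x M
      support x coloured-a with κ x ≟ᶜ a
      ... | yes refl = fit-support fit a≢θ
      per-match : ∀ e f μ → (e , f , μ) ∈ M →
                  2 ∣ ⟦ hasColour κ a e ⟧ + ⟦ hasColour κ a f ⟧ + ⟦ isMinus μ ⟧
      per-match e f μ m with fit-ends fit m
      ... | κe≢θ , κf≢θ = pair-parity μ a≢θ κe≢θ κf≢θ (proj₂ fit e f μ m)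

  fits-balanced : ∀ {θ θ′ κ M M′} → SignedMatching M → Fits θ κ M →
                  SignedMatching M′ → Fits θ′ κ M′ → θ′ ≢ θ → Balanced M
  fits-balanced {θ} {θ′} {κ} {M} matching fit matching′ fit′ θ′≢θ =
    subst (2 ∣_) regroup
      (∣m∣n⇒∣m+n (colour-count-parity matching fit θ′≢θ) (off-colour-even matching′ fit′))
    where
      regroup : count (hasColour κ θ′) + countMinus M + count (not ∘ hasColour κ θ′) ≡ r + countMinus M
      regroup = begin
        count (hasColour κ θ′) + countMinus M + count (not ∘ hasColour κ θ′)
          ≡⟨ xy∙z≈xz∙y (count (hasColour κ θ′)) (countMinus M) _ ⟩
        count (hasColour κ θ′) + count (not ∘ hasColour κ θ′) + countMinus M
          ≡⟨ cong (_+ countMinus M) (count-complement (hasColour κ θ′)) ⟩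
        r + countMinus M ∎

  fits-recolour : ∀ {s θ κ M} → Injective _≡_ _≡_ s → Fits θ κ M → Fits (s θ) (s ∘ κ) M
  fits-recolour {s} s-inj (support , signs) =
    (λ e → (λ sκe≢sθ → proj₁ (support e) (sκe≢sθ ∘ cong s)) ,
           (λ matched sκe≡sθ → proj₂ (support e) matched (s-inj sκe≡sθ))) ,
    (λ e f μ m → (λ sκe≡sκf → proj₁ (signs e f μ m) (s-inj sκe≡sκf)) ,
                 (λ μ≡+ → cong s (proj₂ (signs e f μ m) μ≡+)))

  fits-unrecolour : ∀ {s θ κ M} → Injective _≡_ _≡_ s → Fits (s θ) (s ∘ κ) M → Fits θ κ M
  fits-unrecolour {s} s-inj (support , signs) =
    (λ e → (λ κe≢θ → proj₁ (support e) (κe≢θ ∘ s-inj)) ,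
           (λ matched κe≡θ → proj₂ (support e) matched (cong s κe≡θ))) ,
    (λ e f μ m → (λ κe≡κf → proj₁ (signs e f μ m) (cong s κe≡κf)) ,
                 (λ μ≡+ → s-inj (proj₂ (signs e f μ m) μ≡+)))

  consistent-recolour : ∀ {s 𝒟} → Injective _≡_ _≡_ s → Consistent 𝒟 → Consistent (λ κ → 𝒟 (s ∘ κ))
  consistent-recolour {s} s-inj consistent κ sκ∈𝒟 θ with consistent (s ∘ κ) sκ∈𝒟 (s θ)
  ... | M , matching , fit , fitting⊆𝒟 =
    M , matching , fits-unrecolour s-inj fit , (λ κ′ fit′ → fitting⊆𝒟 (s ∘ κ′) (fits-recolour s-inj fit′))

module Iteration (r : ℕ) (𝒞₀ : Ring.Coloring r → Set)
    (𝒞₀-recolour : ∀ {s} → Injective _≡_ _≡_ s → ∀ {κ} → 𝒞₀ (s ∘ κ) → 𝒞₀ κ) where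
  open Ring r
  open SignedMatchings r

  𝒞′ : Coloring → Set₁
  𝒞′ = MaxConsistent 𝒞₀

  𝒞-decreasing : ∀ j {κ} → 𝒞 𝒞₀ j κ → 𝒞₀ κ
  𝒞-decreasing zero    κ∈𝒞₀ = κ∈𝒞₀
  𝒞-decreasing (suc j) κ∈𝒞 = 𝒞-decreasing j (proj₁ κ∈𝒞)

  𝓜-decreasing : ∀ j {M} → 𝓜 𝒞₀ j M → SignedMatching M × Balanced M
  𝓜-decreasing zero    M∈𝓜₀ = M∈𝓜₀
  𝓜-decreasing (suc j) M∈𝓜 = 𝓜-decreasing j (proj₁ M∈𝓜)

  fixpoint-consistent : ∀ i → (∀ κ → 𝒞 𝒞₀ i κ → 𝒞 𝒞₀ (suc i) κ) → Consistent (𝒞 𝒞₀ i)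
  fixpoint-consistent i stable κ κ∈𝒞ᵢ θ with proj₂ (stable κ κ∈𝒞ᵢ) θ
  ... | M , (M∈𝓜ᵢ , fitting⊆𝒞ᵢ) , fit =
    M , proj₁ (𝓜-decreasing i M∈𝓜ᵢ) , fit , (λ κ′ fit′ → fitting⊆𝒞ᵢ κ′ θ fit′)

  recoloured-in-𝒞′ : ∀ {s 𝒟 κ} → Injective _≡_ _≡_ s → Consistent 𝒟 → (∀ κ → 𝒟 κ → 𝒞₀ κ) →
                     𝒟 (s ∘ κ) → 𝒞′ κ
  recoloured-in-𝒞′ {s} {𝒟} s-inj consistent 𝒟⊆𝒞₀ sκ∈𝒟 =
    (λ κ → 𝒟 (s ∘ κ)) , consistent-recolour s-inj consistent , (λ κ sκ∈𝒟 → 𝒞₀-recolour s-inj (𝒟⊆𝒞₀ _ sκ∈𝒟)) , sκ∈𝒟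

  -- A good matching survives every round of the iteration.
  Good : List SignedMatch → Set₁
  Good M = SignedMatching M × Balanced M × (∀ κ θ → Fits θ κ M → 𝒞′ κ)

  good-witness : ∀ {𝒟 κ} → Consistent 𝒟 → (∀ κ → 𝒟 κ → 𝒞₀ κ) → 𝒟 κ →
                 ∀ θ → ∃ λ M → Good M × Fits θ κ M
  good-witness {𝒟} {κ} consistent 𝒟⊆𝒞₀ κ∈𝒟 θ
    with consistent κ κ∈𝒟 θ | consistent κ κ∈𝒟 (rot θ)
  ... | M , matching , fit , fitting⊆𝒟 | _ , matching′ , fit′ , _ =
    M , (matching , fits-balanced matching fit matching′ fit′ (rot-moves θ) , fitting⊆𝒞′) , fit
    where
      fitting⊆𝒞′ : ∀ κ′ θ′ → Fits θ′ κ′ M → 𝒞′ κ′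
      fitting⊆𝒞′ κ′ θ′ θ′-fit with rot-transitive θ′ θ
      ... | k , rotᵏθ′≡θ = recoloured-in-𝒞′ rotᵏ-inj consistent 𝒟⊆𝒞₀
        (fitting⊆𝒟 _ (subst (λ c → Fits c (iter rot k ∘ κ′) M) rotᵏθ′≡θ (fits-recolour rotᵏ-inj θ′-fit)))
        where
          rotᵏ-inj : Injective _≡_ _≡_ (iter rot k)
          rotᵏ-inj = iter-injective rot-injective k

  stages : ∀ j → (∀ κ → 𝒞′ κ → 𝒞 𝒞₀ j κ) × (∀ M → Good M → 𝓜 𝒞₀ j M)
  stages zero = (λ { κ (𝒟 , _ , 𝒟⊆𝒞₀ , κ∈𝒟) → 𝒟⊆𝒞₀ κ κ∈𝒟 }) , (λ { M (matching , balanced , _) → matching , balanced })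
  stages (suc j) = 𝒞′⊆𝒞ⱼ₊₁ , good⊆𝓜ⱼ₊₁
    where
      good⊆𝓜ⱼ₊₁ : ∀ M → Good M → 𝓜 𝒞₀ (suc j) M
      good⊆𝓜ⱼ₊₁ M good = proj₂ (stages j) M good , λ κ θ fit → proj₁ (stages j) κ (proj₂ (proj₂ good) κ θ fit)
      𝒞′⊆𝒞ⱼ₊₁ : ∀ κ → 𝒞′ κ → 𝒞 𝒞₀ (suc j) κ
      𝒞′⊆𝒞ⱼ₊₁ κ κ∈𝒞′@(𝒟 , consistent , 𝒟⊆𝒞₀ , κ∈𝒟) = proj₁ (stages j) κ κ∈𝒞′ , witnesses
        where
          witnesses : ∀ θ → ∃ λ M → 𝓜 𝒞₀ (suc j) M × Fits θ κ M
          witnesses θ with good-witness consistent 𝒟⊆𝒞₀ κ∈𝒟 θ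
          ... | M , good , fit = M , good⊆𝓜ⱼ₊₁ M good , fit

  fixpoint-is-𝒞′ : ∀ i → (∀ κ → Iff (𝒞 𝒞₀ i κ) (𝒞 𝒞₀ (suc i) κ)) → ∀ κ → Iff (𝒞′ κ) (𝒞 𝒞₀ i κ)
  fixpoint-is-𝒞′ i fixpoint κ =
    proj₁ (stages i) κ ,
    λ κ∈𝒞ᵢ → 𝒞 𝒞₀ i , fixpoint-consistent i (λ κ → proj₁ (fixpoint κ)) , (λ κ → 𝒞-decreasing i) , κ∈𝒞ᵢ

CK-recolour : ∀ T {s} → Injective _≡_ _≡_ s → ∀ {κ} → CK T κ → CK T (s ∘ κ)
CK-recolour T {s} s-inj (τ , tri , on-ring) =
  s ∘ τ , (λ x y same-face finite x≢y sτx≡sτy → tri x y same-face finite x≢y (s-inj sτx≡sτy)) ,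
  (λ i → cong s (on-ring i))

mainTheorem2 : (T : RingedNearTriangulation) → IsConfiguration T →
    let r = RingedNearTriangulation.r T
        𝒞₀ = λ (κ : Ring.Coloring r) → ¬ CK T κ
    in (i : ℕ) →
       (∀ κ → Iff (Ring.𝒞 r 𝒞₀ i κ) (Ring.𝒞 r 𝒞₀ (suc i) κ)) →
       ∀ κ → Iff (Ring.MaxConsistent r 𝒞₀ κ) (Ring.𝒞 r 𝒞₀ i κ)
mainTheorem2 T _ = Iteration.fixpoint-is-𝒞′ (RingedNearTriangulation.r T) (λ κ → ¬ CK T κ)
  (λ s-inj sκ∉CK κ∈CK → sκ∉CK (CK-recolour T s-inj κ∈CK))
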